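{- Let $G$ be a finite simple undirected graph and $g$ a positive integer. If the procedure Burn-Guess$(G,g)$ returns a burning sequence, then burning $G$ according to that sequence completes within at most $3g-3$ rounds.
   Context: Graph burning: rounds $1,2,\dots$; initially nothing burns; in each round every neighbour of a burning vertex becomes burning and a new fire is started at the activator of that round (if the designated activator is already burning, nothing further happens). A vertex stays burning forever; the graph is burned when all vertices are burning. Procedure Burn-Guess$(G,g)$: it processes the vertices of $G$ one by one in an arbitrary order, maintaining a set of centers, initially empty. When a vertex $v$ is processed, if $v$ is at distance at most $2g-2$ from some current center it is marked non-center; otherwise $v$ is added to the set of centers. If after processing any vertex the number of centers equals $g$, the procedure stops and returns Bad-Guess. If all vertices are processed without this happening, it returns the burning sequence consisting of the centers in an arbitrary order (the $i$-th center is the activator of round $i$). -}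

module Defs where

open import Data.Nat using (ℕ; zero; suc; _≤_; _∸_; _*_)
open import Data.Fin using (Fin)
open import Data.Bool using (Bool; true; false)
open import Data.List using (List; []; _∷_; length)
open import Data.List.Membership.Propositional using (_∈_)
open import Data.Maybe using (Maybe; just; nothing)
open import Data.Product using (Σ; ∃; _×_; _,_)
open import Relation.Binary.PropositionalEquality using (_≡_; _≢_)
open import Relation.Nullary using (¬_)

record Graph : Set where
  field
    n     : ℕ
    adj   : Fin n → Fin n → Bool
    sym   : ∀ u v → adj u v ≡ adj v u
    irrefl : ∀ v → adj v v ≡ false

open Graph public

Vertex : Graph → Set
Vertex G = Fin (n G)

Adj : (G : Graph) → Vertex G → Vertex G → Set
Adj G u v = adj G u v ≡ true

data Walk (G : Graph) : ℕ → Vertex G → Vertex G → Set where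
  here : ∀ {u} → Walk G zero u u
  step : ∀ {k u v w} → Adj G u v → Walk G k v w → Walk G (suc k) u w

-- dist_G(u,v) ≤ d  (shortest-path distance; false when disconnected)
DistLE : (G : Graph) → ℕ → Vertex G → Vertex G → Set
DistLE G d u v = Σ ℕ λ k → k ≤ d × Walk G k u v

data Outcome (G : Graph) : Set where
  badGuess : Outcome G
  centers  : List (Vertex G) → Outcome G

NearCenter : (G : Graph) → ℕ → List (Vertex G) → Vertex G → Set
NearCenter G g cs v = Σ (Vertex G) λ c → c ∈ cs × DistLE G (2 * g ∸ 2) v c

-- BurnGuessRun G g cs vs o : processing the remaining vertices vs, starting
-- from the current set of centers cs, the procedure ends with outcome o.
data BurnGuessRun (G : Graph) (g : ℕ) :
       List (Vertex G) → List (Vertex G) → Outcome G → Set where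
  finish  : ∀ {cs} → BurnGuessRun G g cs [] (centers cs)
  nonCenter : ∀ {cs v vs o} → NearCenter G g cs v →
              BurnGuessRun G g cs vs o → BurnGuessRun G g cs (v ∷ vs) o
  newCenterStop : ∀ {cs v vs} → ¬ NearCenter G g cs v →
              length (v ∷ cs) ≡ g → BurnGuessRun G g cs (v ∷ vs) badGuess
  newCenter : ∀ {cs v vs o} → ¬ NearCenter G g cs v →
              length (v ∷ cs) ≢ g →
              BurnGuessRun G g (v ∷ cs) vs o → BurnGuessRun G g cs (v ∷ vs) o

BurnGuess : (G : Graph) → ℕ → List (Vertex G) → Outcome G → Set
BurnGuess G g order o = BurnGuessRun G g [] order o

_!_ : {A : Set} → List A → ℕ → Maybe A
[] ! _ = nothing
(x ∷ xs) ! zero = just x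
(x ∷ xs) ! suc i = xs ! i

-- Burning G S t v : vertex v is burning at the end of round t when the graph is
-- burned with burning sequence S (S ! (t-1) is the activator of round t).
data Burning (G : Graph) (S : List (Vertex G)) : ℕ → Vertex G → Set where
  stay   : ∀ {t v} → Burning G S t v → Burning G S (suc t) v
  spread : ∀ {t u v} → Burning G S t u → Adj G u v → Burning G S (suc t) v
  fire   : ∀ {t v} → S ! t ≡ just v → Burning G S (suc t) v

BurnedBy : (G : Graph) → List (Vertex G) → ℕ → Set
BurnedBy G S t = ∀ v → Burning G S t v

-- Every vertex ends up within distance 2g-2 of some center (it is either near an
-- existing center or becomes one), and fewer than g centers are ever chosen. The
-- center fired in round i+1 ≤ g-1 then reaches every vertex within distance
-- 2g-2 of it by round (2g-2) + (g-1) = 3g-3.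
module Submission where

open import Defs
open import Data.Nat using (ℕ; _≤_; _∸_; _*_; _+_; _<_; zero; suc; z≤n; s≤s)
open import Data.Nat.Properties
  using (≤-refl; ≤-trans; ≤∧≢⇒<; +-mono-≤; +-comm; *-distribˡ-∸; ∸-monoˡ-≤; m∸n+n≡m)
open import Data.List using (List; allFin; []; _∷_; length)
open import Data.List.Relation.Binary.Subset.Propositional using (_⊆_)
open import Data.List.Relation.Binary.Permutation.Propositional using (_↭_; ↭-sym)
open import Data.List.Relation.Binary.Permutation.Propositional.Properties using (∈-resp-↭; ↭-length)
open import Data.List.Membership.Propositional using (_∈_)
open import Data.List.Membership.Propositional.Properties using (∈-allFin)
open import Data.List.Relation.Unary.Any using (here; there)
open import Data.Product using (Σ; _×_; _,_)
open import Data.Maybe using (just)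
open import Relation.Binary.PropositionalEquality using (_≡_; refl; trans; subst) renaming (sym to ≡-sym)

module _ {G : Graph} {g : ℕ} where

  run-centers-⊆ : ∀ {cs vs cf} → BurnGuessRun G g cs vs (centers cf) → cs ⊆ cf
  run-centers-⊆ finish              = λ c∈ → c∈
  run-centers-⊆ (nonCenter _ r)     = run-centers-⊆ r
  run-centers-⊆ (newCenter _ _ r)   = λ c∈ → run-centers-⊆ r (there c∈)

  run-nearCenter : ∀ {cs vs cf v} → BurnGuessRun G g cs vs (centers cf) →
                   v ∈ vs → NearCenter G g cf v
  run-nearCenter (nonCenter (c , c∈ , d) r) (here refl) = c , run-centers-⊆ r c∈ , d
  run-nearCenter (nonCenter _ r)            (there v∈)  = run-nearCenter r v∈
  run-nearCenter (newCenter _ _ r)          (here refl) =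
    _ , run-centers-⊆ r (here refl) , (0 , z≤n , here)
  run-nearCenter (newCenter _ _ r)          (there v∈)  = run-nearCenter r v∈

  run-length< : ∀ {cs vs cf} → BurnGuessRun G g cs vs (centers cf) →
                length cs < g → length cf < g
  run-length< finish               lt = lt
  run-length< (nonCenter _ r)      lt = run-length< r lt
  run-length< (newCenter _ len≢ r) lt = run-length< r (≤∧≢⇒< lt len≢)

∈⇒! : ∀ {A : Set} {x : A} {xs : List A} → x ∈ xs →
      Σ ℕ λ i → i < length xs × xs ! i ≡ just x
∈⇒! (here refl) = 0 , s≤s z≤n , refl
∈⇒! (there x∈) with ∈⇒! x∈
... | i , i< , xs!i = suc i , s≤s i< , xs!i

module _ {G : Graph} {S : List (Vertex G)} where

  Burning-walk : ∀ {k u c t} → Walk G k u c → Burning G S t c → Burning G S (k + t) u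
  Burning-walk here             b = b
  Burning-walk (step {u = u} {v = v} uv w) b =
    spread (Burning-walk w b) (trans (Graph.sym G v u) uv)

  Burning-+ : ∀ {t v} m → Burning G S t v → Burning G S (m + t) v
  Burning-+ zero    b = b
  Burning-+ (suc m) b = stay (Burning-+ m b)

  Burning-mono : ∀ {t t′ v} → t ≤ t′ → Burning G S t v → Burning G S t′ v
  Burning-mono {t} {t′} {v} t≤t′ b =
    subst (λ s → Burning G S s v) (m∸n+n≡m t≤t′) (Burning-+ (t′ ∸ t) b)

-- 2g-2 = 2(g-1) and 3g-3 = 3(g-1), also when g = 0 thanks to truncated subtraction.
distance+round≤3g∸3 : ∀ g {k r} → k ≤ 2 * g ∸ 2 → r ≤ g ∸ 1 → k + r ≤ 3 * g ∸ 3
distance+round≤3g∸3 g {k} {r} k≤ r≤ =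
  subst (k + r ≤_) (*-distribˡ-∸ 3 g 1)
    (subst (k + r ≤_) (+-comm (2 * h) h)
      (+-mono-≤ (subst (k ≤_) (≡-sym (*-distribˡ-∸ 2 g 1)) k≤) r≤))
  where h = g ∸ 1

lemma3 : (G : Graph) (g : ℕ) → 1 ≤ g →
    (order : List (Vertex G)) → order ↭ allFin (n G) →
    (cs : List (Vertex G)) → BurnGuess G g order (centers cs) →
    (S : List (Vertex G)) → S ↭ cs →
    Σ ℕ λ t → t ≤ 3 * g ∸ 3 × BurnedBy G S t
lemma3 G g 1≤g order order↭ cs run S S↭cs = 3 * g ∸ 3 , ≤-refl , burned
  where
  |S|<g : length S < g
  |S|<g = subst (_< g) (↭-length (↭-sym S↭cs)) (run-length< run 1≤g)

  burned : BurnedBy G S (3 * g ∸ 3)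
  burned v with run-nearCenter run (∈-resp-↭ (↭-sym order↭) (∈-allFin v))
  ... | c , c∈cs , (k , k≤ , walk) with ∈⇒! (∈-resp-↭ (↭-sym S↭cs) c∈cs)
  ... | i , i<|S| , S!i =
    Burning-mono (distance+round≤3g∸3 g k≤ (∸-monoˡ-≤ 1 (≤-trans (s≤s i<|S|) |S|<g)))
                 (Burning-walk walk (fire S!i))
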